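{- Let $d\ge0$ and let $C_1,\dots,C_{2^d}$ be the columns of the matrix $M_d$. For all integers $i,k$ with $1\le i\le 2^d$ and $k\ge0$, there exist $b_{i+1},\dots,b_{2^d}\in\mathbb{F}_2$ such that $\sigma^k(C_i)\oplus C_i=\bigoplus_{j=i+1}^{2^d} b_jC_j$ (an empty sum being the zero vector).
   Context: Matrices over $\mathbb{F}_2$: $M_0=(1)$ and $M_{d+1}=\begin{pmatrix}M_d&M_d\\0&M_d\end{pmatrix}$, so $M_d$ is $2^d\times 2^d$. $\sigma$ maps a column vector $(a_1,\dots,a_n)^t$ to $(a_n,a_1,\dots,a_{n-1})^t$; $\oplus$ is componentwise addition mod $2$. -}

module Defs where

open import Data.Nat using (ℕ; zero; suc; _+_; _^_; _<_)
open import Data.Nat.Properties using (+-identityʳ)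
open import Data.Fin using (Fin; zero; suc; toℕ; splitAt; cast)
open import Data.Bool using (Bool; true; false; _xor_; _∧_; if_then_else_)
open import Data.Sum using (inj₁; inj₂)
open import Relation.Binary.PropositionalEquality using (_≡_; cong)
open import Relation.Nullary.Decidable using (⌊_⌋)
open import Data.Nat using (_<?_)

-- F₂ is modelled by Bool: addition is xor, multiplication is ∧.

-- 2 ^ (suc d) ≡ 2 ^ d + 2 ^ d (definitionally 2 ^ d + (2 ^ d + 0))
pow-split : (d : ℕ) → 2 ^ suc d ≡ 2 ^ d + 2 ^ d
pow-split d = cong (2 ^ d +_) (+-identityʳ (2 ^ d))

-- Vectors in F₂^n as functions, matrices as (row, column) ↦ entry.
Vec₂ : ℕ → Set
Vec₂ n = Fin n → Bool

M : (d : ℕ) → Fin (2 ^ d) → Fin (2 ^ d) → Bool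
M zero    r c = true
M (suc d) r c with splitAt (2 ^ d) (cast (pow-split d) r)
                 | splitAt (2 ^ d) (cast (pow-split d) c)
... | inj₁ r' | inj₁ c' = M d r' c'
... | inj₁ r' | inj₂ c' = M d r' c'
... | inj₂ r' | inj₁ c' = false
... | inj₂ r' | inj₂ c' = M d r' c'

-- Column c of M d (columns indexed from 0: C_{i} in the paper is column i-1).
col : (d : ℕ) → Fin (2 ^ d) → Vec₂ (2 ^ d)
col d c r = M d r c

σ : {n : ℕ} → Vec₂ n → Vec₂ n
σ {zero}  v ()
σ {suc n} v zero    = v (Data.Fin.fromℕ n)
σ {suc n} v (suc p) = v (Data.Fin.inject₁ p)

σ^ : {n : ℕ} → ℕ → Vec₂ n → Vec₂ n
σ^ zero    v = v
σ^ (suc k) v = σ (σ^ k v)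

_⊕_ : {n : ℕ} → Vec₂ n → Vec₂ n → Vec₂ n
(u ⊕ v) r = u r xor v r

zeroV : {n : ℕ} → Vec₂ n
zeroV r = false

sumV : {n : ℕ} (m : ℕ) → (Fin m → Vec₂ n) → Vec₂ n
sumV zero    f = zeroV
sumV (suc m) f = f zero ⊕ sumV m (λ j → f (suc j))

_·_ : {n : ℕ} → Bool → Vec₂ n → Vec₂ n
(b · v) r = b ∧ v r

laterComb : (d : ℕ) → Fin (2 ^ d) → (Fin (2 ^ d) → Bool) → Vec₂ (2 ^ d)
laterComb d i b = sumV (2 ^ d) (λ j →
  if ⌊ toℕ i <? toℕ j ⌋ then (b j · col d j) else zeroV)

{-# OPTIONS --safe #-}
-- Write Δ v = σ v ⊕ v. Column c of M d holds the binomial coefficients (c choose r) mod 2, so the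
-- columns obey Pascal's rule Δ C_c = C_{c+1}, while the last column is all ones and Δ C_last = 0.
-- This is proved by induction on d, viewing each column of M (d+1) as two glued blocks of height
-- 2^d on which σ acts blockwise, up to the last entries of the blocks changing places.
-- Hence for j > i the vector σ C_j = Δ C_j ⊕ C_j lies in the span W_i of the columns after C_i,
-- so W_i is σ-invariant, and σ^(k+1) C_i ⊕ C_i = σ (σ^k C_i ⊕ C_i) ⊕ Δ C_i lies in W_i by induction on k.
module Submission where

open import Defs
open import Algebra.Bundles using (CommutativeRing)
open import Data.Bool using (Bool; true; false; _xor_; _∧_; if_then_else_)
open import Data.Bool.Properties using (xor-∧-commutativeRing; xor-assoc; xor-same; xor-identityʳ; ∧-distribʳ-xor)
open import Data.Fin using (Fin; zero; suc; toℕ; splitAt; cast; _↑ˡ_; _↑ʳ_; fromℕ; inject₁; fromℕ<; _≟_)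
open import Data.Fin.Properties
  using (toℕ-injective; toℕ-cast; toℕ-↑ˡ; toℕ-↑ʳ; toℕ<n; splitAt-↑ˡ; splitAt-↑ʳ; splitAt⁻¹-↑ˡ; splitAt⁻¹-↑ʳ;
         cast-involutive; toℕ-fromℕ; toℕ-inject₁; toℕ-fromℕ<)
  renaming (suc-injective to Fin-suc-injective)
open import Data.Nat using (ℕ; zero; suc; _+_; _^_; _<_; _≤_; s≤s; s≤s⁻¹; z<s; _<?_)
open import Data.Nat.Properties
  using (suc-injective; +-suc; +-identityʳ; +-cancelˡ-≡; +-cancelˡ-≤; +-cancelˡ-<; m≤m+n; m<m+n; m^n>0;
         <-≤-trans; ≤-<-trans; <-asym; <⇒≤; <⇒≢; n≤0⇒n≡0; ≤-refl; m≤n⇒m<n∨m≡n)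
open import Data.Product using (∃; _,_; _×_; proj₁; proj₂)
open import Data.Sum using (_⊎_; inj₁; inj₂; [_,_]′)
open import Function using (_∘_)
open import Relation.Binary.PropositionalEquality
open import Relation.Nullary using (yes; no; contradiction)
open import Relation.Nullary.Decidable using (⌊_⌋)

open CommutativeRing xor-∧-commutativeRing using (+-commutativeSemigroup)
open import Algebra.Properties.CommutativeSemigroup +-commutativeSemigroup using (interchange)

xor-cancel-middle : ∀ a b c → (a xor b) xor (b xor c) ≡ a xor c
xor-cancel-middle a b c = begin
  (a xor b) xor (b xor c)  ≡⟨ xor-assoc a b (b xor c) ⟩
  a xor (b xor (b xor c))  ≡⟨ cong (a xor_) (sym (xor-assoc b b c)) ⟩
  a xor ((b xor b) xor c)  ≡⟨ cong (λ x → a xor (x xor c)) (xor-same b) ⟩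
  a xor c                  ∎
  where open ≡-Reasoning

ones : ∀ {n} → Vec₂ n
ones _ = true

π : ∀ {n} → Fin n → Fin n
π {suc n} zero    = fromℕ n
π {suc n} (suc p) = inject₁ p

σ-π : ∀ {n} (v : Vec₂ n) → σ v ≗ v ∘ π
σ-π {suc n} v zero    = refl
σ-π {suc n} v (suc p) = refl

σ-cong : ∀ {n} {u v : Vec₂ n} → u ≗ v → σ u ≗ σ v
σ-cong {u = u} {v} u≗v p = trans (σ-π u p) (trans (u≗v (π p)) (sym (σ-π v p)))

σ-⊕ : ∀ {n} (u v : Vec₂ n) → σ (u ⊕ v) ≗ σ u ⊕ σ v
σ-⊕ u v p = trans (σ-π (u ⊕ v) p) (sym (cong₂ _xor_ (σ-π u p) (σ-π v p)))

σ-· : ∀ {n} β (v : Vec₂ n) → σ (β · v) ≗ β · σ v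
σ-· β v p = trans (σ-π (β · v) p) (sym (cong (β ∧_) (σ-π v p)))

σ-const : ∀ {n} (b : Bool) → σ {n} (λ _ → b) ≗ (λ _ → b)
σ-const b = σ-π (λ _ → b)

σ-at-suc : ∀ {n} (v : Vec₂ n) {p q : Fin n} → toℕ p ≡ suc (toℕ q) → σ v p ≡ v q
σ-at-suc {suc n} v {suc p} e = cong v (toℕ-injective (trans (toℕ-inject₁ p) (suc-injective e)))

σ-at-zero : ∀ {n} (v : Vec₂ n) {p q : Fin n} → toℕ p ≡ 0 → suc (toℕ q) ≡ n → σ v p ≡ v q
σ-at-zero {suc n} v {zero} _ e = cong v (toℕ-injective (trans (toℕ-fromℕ n) (sym (suc-injective e))))

zero-or-suc : ∀ {n} (r : Fin n) → toℕ r ≡ 0 ⊎ ∃ λ (q : Fin n) → toℕ r ≡ suc (toℕ q)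
zero-or-suc zero    = inj₁ refl
zero-or-suc (suc q) = inj₂ (inject₁ q , cong suc (sym (toℕ-inject₁ q)))

∃-last : ∀ {n} → Fin n → ∃ λ (L : Fin n) → suc (toℕ L) ≡ n
∃-last {suc n} _ = fromℕ n , cong suc (toℕ-fromℕ n)

Δ : ∀ {n} → Vec₂ n → Vec₂ n
Δ v = σ v ⊕ v

Δ-const : ∀ {n} (b : Bool) → Δ {n} (λ _ → b) ≗ zeroV
Δ-const b p = trans (cong (_xor b) (σ-const b p)) (xor-same b)

σ-via-Δ : ∀ {n} (v : Vec₂ n) → σ v ≗ Δ v ⊕ v
σ-via-Δ v p = sym (trans (xor-assoc (σ v p) (v p) (v p))
                         (trans (cong (σ v p xor_) (xor-same (v p))) (xor-identityʳ (σ v p))))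

Δ-cong : ∀ {n} {u v : Vec₂ n} → u ≗ v → Δ u ≗ Δ v
Δ-cong u≗v p = cong₂ _xor_ (σ-cong u≗v p) (u≗v p)

σ-⊕-telescope : ∀ {n} (u v : Vec₂ n) → σ u ⊕ v ≗ σ (u ⊕ v) ⊕ Δ v
σ-⊕-telescope u v p = begin
  σ u p xor v p                              ≡⟨ sym (xor-cancel-middle (σ u p) (σ v p) (v p)) ⟩
  (σ u p xor σ v p) xor (σ v p xor v p)      ≡⟨ cong (_xor Δ v p) (sym (σ-⊕ u v p)) ⟩
  σ (u ⊕ v) p xor Δ v p                      ∎
  where open ≡-Reasoning

sumV-cong : ∀ {n} k {f g : Fin k → Vec₂ n} → (∀ j → f j ≗ g j) → sumV k f ≗ sumV k g
sumV-cong zero    f≗g p = refl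
sumV-cong (suc k) f≗g p = cong₂ _xor_ (f≗g zero p) (sumV-cong k (f≗g ∘ suc) p)

sumV-⊕ : ∀ {n} k (f g : Fin k → Vec₂ n) → sumV k (λ j → f j ⊕ g j) ≗ sumV k f ⊕ sumV k g
sumV-⊕ zero    f g p = refl
sumV-⊕ (suc k) f g p =
  trans (cong ((f zero p xor g zero p) xor_) (sumV-⊕ k (f ∘ suc) (g ∘ suc) p))
        (interchange (f zero p) (g zero p) _ _)

sumV-zero : ∀ {n} k {f : Fin k → Vec₂ n} → (∀ j → f j ≗ zeroV) → sumV k f ≗ zeroV
sumV-zero zero    f≗0 p = refl
sumV-zero (suc k) f≗0 p = cong₂ _xor_ (f≗0 zero p) (sumV-zero k (f≗0 ∘ suc) p)

sumV-single : ∀ {n} k (f : Fin k → Vec₂ n) (j : Fin k) →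
              (∀ l → l ≢ j → f l ≗ zeroV) → sumV k f ≗ f j
sumV-single (suc k) f zero    others p =
  trans (cong (f zero p xor_) (sumV-zero k (λ l → others (suc l) (λ ())) p)) (xor-identityʳ (f zero p))
sumV-single (suc k) f (suc j) others p =
  cong₂ _xor_ (others zero (λ ()) p)
              (sumV-single k (f ∘ suc) j (λ l l≢j → others (suc l) (l≢j ∘ Fin-suc-injective)) p)

σ-sumV : ∀ {n} k (f : Fin k → Vec₂ n) → σ (sumV k f) ≗ sumV k (σ ∘ f)
σ-sumV zero    f p = σ-const false p
σ-sumV (suc k) f p =
  trans (σ-⊕ (f zero) (sumV k (f ∘ suc)) p) (cong (σ (f zero) p xor_) (σ-sumV k (f ∘ suc) p))

module Span {m n : ℕ} (P : Fin m → Bool) (f : Fin m → Vec₂ n) where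

  comb : (Fin m → Bool) → Vec₂ n
  comb b = sumV m (λ j → if P j then b j · f j else zeroV)

  InSpan : Vec₂ n → Set
  InSpan v = ∃ λ b → v ≗ comb b

  inSpan-resp : ∀ {u v} → u ≗ v → InSpan v → InSpan u
  inSpan-resp u≗v (b , v≗) = b , λ p → trans (u≗v p) (v≗ p)

  zero-inSpan : InSpan zeroV
  zero-inSpan = (λ _ → false) , λ p → sym (sumV-zero m term≗0 p)
    where
    term≗0 : ∀ j → (if P j then false · f j else zeroV) ≗ zeroV
    term≗0 j p with P j
    ... | true  = refl
    ... | false = refl

  ⊕-inSpan : ∀ {u v} → InSpan u → InSpan v → InSpan (u ⊕ v)
  ⊕-inSpan (b , u≗) (c , v≗) = (λ j → b j xor c j) , λ p →
    trans (cong₂ _xor_ (u≗ p) (v≗ p)) (sym (trans (sumV-cong m term-⊕ p) (sumV-⊕ m _ _ p)))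
    where
    term-⊕ : ∀ j → (if P j then (b j xor c j) · f j else zeroV)
                 ≗ (if P j then b j · f j else zeroV) ⊕ (if P j then c j · f j else zeroV)
    term-⊕ j p with P j
    ... | true  = ∧-distribʳ-xor (f j p) (b j) (c j)
    ... | false = refl

  ·-inSpan : ∀ β {v} → InSpan v → InSpan (β · v)
  ·-inSpan false _ = inSpan-resp (λ _ → refl) zero-inSpan
  ·-inSpan true  s = inSpan-resp (λ _ → refl) s

  generator-inSpan : ∀ j → P j ≡ true → InSpan (f j)
  generator-inSpan j Pj = (λ l → ⌊ l ≟ j ⌋) , λ p → sym (trans (sumV-single m _ j others p) (at-j p))
    where
    others : ∀ l → l ≢ j → (if P l then ⌊ l ≟ j ⌋ · f l else zeroV) ≗ zeroV
    others l l≢j p with P l | l ≟ j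
    ... | _     | yes l≡j = contradiction l≡j l≢j
    ... | true  | no _    = refl
    ... | false | no _    = refl
    at-j : (if P j then ⌊ j ≟ j ⌋ · f j else zeroV) ≗ f j
    at-j p rewrite Pj with j ≟ j
    ... | yes _   = refl
    ... | no j≢j  = contradiction refl j≢j

  sumV-inSpan : ∀ k {g : Fin k → Vec₂ n} → (∀ j → InSpan (g j)) → InSpan (sumV k g)
  sumV-inSpan zero    _  = zero-inSpan
  sumV-inSpan (suc k) gs = ⊕-inSpan (gs zero) (sumV-inSpan k (gs ∘ suc))

  σ-inSpan : (∀ j → P j ≡ true → InSpan (σ (f j))) → ∀ {v} → InSpan v → InSpan (σ v)
  σ-inSpan σ-generators (b , v≗) =
    inSpan-resp (λ p → trans (σ-cong v≗ p) (σ-sumV m _ p)) (sumV-inSpan m σ-term)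
    where
    σ-term : ∀ j → InSpan (σ (if P j then b j · f j else zeroV))
    σ-term j with P j in Pj
    ... | true  = inSpan-resp (σ-· (b j) (f j)) (·-inSpan (b j) (σ-generators j Pj))
    ... | false = inSpan-resp (σ-const false) zero-inSpan

module _ (d : ℕ) where

  top bottom : Fin (2 ^ d) → Fin (2 ^ suc d)
  top    r = cast (sym (pow-split d)) (r ↑ˡ 2 ^ d)
  bottom r = cast (sym (pow-split d)) (2 ^ d ↑ʳ r)

  toℕ-top : ∀ r → toℕ (top r) ≡ toℕ r
  toℕ-top r = trans (toℕ-cast _ (r ↑ˡ 2 ^ d)) (toℕ-↑ˡ r (2 ^ d))

  toℕ-bottom : ∀ r → toℕ (bottom r) ≡ 2 ^ d + toℕ r
  toℕ-bottom r = trans (toℕ-cast _ (2 ^ d ↑ʳ r)) (toℕ-↑ʳ (2 ^ d) r)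

  top-or-bottom : ∀ x → (∃ λ r → x ≡ top r) ⊎ (∃ λ r → x ≡ bottom r)
  top-or-bottom x with splitAt (2 ^ d) (cast (pow-split d) x) in eq
  ... | inj₁ r = inj₁ (r , sym (trans (cong (cast (sym (pow-split d))) (splitAt⁻¹-↑ˡ eq))
                                      (cast-involutive (sym (pow-split d)) (pow-split d) x)))
  ... | inj₂ r = inj₂ (r , sym (trans (cong (cast (sym (pow-split d))) (splitAt⁻¹-↑ʳ eq))
                                      (cast-involutive (sym (pow-split d)) (pow-split d) x)))

  splitAt-top : ∀ r → splitAt (2 ^ d) (cast (pow-split d) (top r)) ≡ inj₁ r
  splitAt-top r = trans (cong (splitAt (2 ^ d)) (cast-involutive (pow-split d) (sym (pow-split d)) (r ↑ˡ 2 ^ d)))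
                        (splitAt-↑ˡ (2 ^ d) r (2 ^ d))

  splitAt-bottom : ∀ r → splitAt (2 ^ d) (cast (pow-split d) (bottom r)) ≡ inj₂ r
  splitAt-bottom r = trans (cong (splitAt (2 ^ d)) (cast-involutive (pow-split d) (sym (pow-split d)) (2 ^ d ↑ʳ r)))
                           (splitAt-↑ʳ (2 ^ d) (2 ^ d) r)

  glue : Vec₂ (2 ^ d) → Vec₂ (2 ^ d) → Vec₂ (2 ^ suc d)
  glue u v x = [ u , v ]′ (splitAt (2 ^ d) (cast (pow-split d) x))

  glue-top : ∀ u v r → glue u v (top r) ≡ u r
  glue-top u v r = cong [ u , v ]′ (splitAt-top r)

  glue-bottom : ∀ u v r → glue u v (bottom r) ≡ v r
  glue-bottom u v r = cong [ u , v ]′ (splitAt-bottom r)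

  glue-⊕ : ∀ u v u′ v′ → glue u v ⊕ glue u′ v′ ≗ glue (u ⊕ u′) (v ⊕ v′)
  glue-⊕ u v u′ v′ x with splitAt (2 ^ d) (cast (pow-split d) x)
  ... | inj₁ r = refl
  ... | inj₂ r = refl

  glue-cong : ∀ {u v u′ v′} → u ≗ u′ → v ≗ v′ → glue u v ≗ glue u′ v′
  glue-cong u≗ v≗ x with splitAt (2 ^ d) (cast (pow-split d) x)
  ... | inj₁ r = u≗ r
  ... | inj₂ r = v≗ r

  col-top : ∀ c → col (suc d) (top c) ≗ glue (col d c) zeroV
  col-top c x rewrite splitAt-top c with splitAt (2 ^ d) (cast (pow-split d) x)
  ... | inj₁ r = refl
  ... | inj₂ r = refl

  col-bottom : ∀ c → col (suc d) (bottom c) ≗ glue (col d c) (col d c)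
  col-bottom c x rewrite splitAt-bottom c with splitAt (2 ^ d) (cast (pow-split d) x)
  ... | inj₁ r = refl
  ... | inj₂ r = refl

  0<2^d : 0 < 2 ^ d
  0<2^d = m^n>0 2 d

  top<bottom : ∀ r c → toℕ (top r) < toℕ (bottom c)
  top<bottom r c = subst₂ _<_ (sym (toℕ-top r)) (sym (toℕ-bottom c))
                          (<-≤-trans (toℕ<n r) (m≤m+n (2 ^ d) (toℕ c)))

  bottom≢0 : ∀ r → toℕ (bottom r) ≢ 0
  bottom≢0 r e = <⇒≢ (<-≤-trans 0<2^d (m≤m+n (2 ^ d) (toℕ r))) (trans (sym e) (toℕ-bottom r))

  suc-toℕ-bottom : ∀ r → suc (toℕ (bottom r)) ≡ 2 ^ d + suc (toℕ r)
  suc-toℕ-bottom r = trans (cong suc (toℕ-bottom r)) (sym (+-suc (2 ^ d) (toℕ r)))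

  top-not-last : ∀ c → suc (toℕ (top c)) ≢ 2 ^ suc d
  top-not-last c = <⇒≢ (subst₂ _<_ (cong suc (sym (toℕ-top c))) (sym (pow-split d))
                                   (≤-<-trans (toℕ<n c) (m<m+n (2 ^ d) 0<2^d)))

  bottom-last⇒last : ∀ c → suc (toℕ (bottom c)) ≡ 2 ^ suc d → suc (toℕ c) ≡ 2 ^ d
  bottom-last⇒last c e = +-cancelˡ-≡ (2 ^ d) _ _ (trans (sym (suc-toℕ-bottom c)) (trans e (pow-split d)))

  last⇒bottom-last : ∀ c → suc (toℕ c) ≡ 2 ^ d → suc (toℕ (bottom c)) ≡ 2 ^ suc d
  last⇒bottom-last c e = trans (suc-toℕ-bottom c) (trans (cong (2 ^ d +_) e) (sym (pow-split d)))

  succ-top-top : ∀ {c c′} → toℕ (top c′) ≡ suc (toℕ (top c)) → toℕ c′ ≡ suc (toℕ c)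
  succ-top-top {c} {c′} e = trans (sym (toℕ-top c′)) (trans e (cong suc (toℕ-top c)))

  succ-bottom-bottom : ∀ {c c′} → toℕ (bottom c′) ≡ suc (toℕ (bottom c)) → toℕ c′ ≡ suc (toℕ c)
  succ-bottom-bottom {c} {c′} e =
    +-cancelˡ-≡ (2 ^ d) _ _ (trans (sym (toℕ-bottom c′)) (trans e (suc-toℕ-bottom c)))

  succ-top-bottom : ∀ {c c′} → toℕ (bottom c′) ≡ suc (toℕ (top c)) → toℕ c′ ≡ 0 × suc (toℕ c) ≡ 2 ^ d
  succ-top-bottom {c} {c′} e = c′≡0 , trans (sym e′) (trans (cong (2 ^ d +_) c′≡0) (+-identityʳ (2 ^ d)))
    where
    e′ : 2 ^ d + toℕ c′ ≡ suc (toℕ c)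
    e′ = trans (sym (toℕ-bottom c′)) (trans e (cong suc (toℕ-top c)))
    c′≡0 : toℕ c′ ≡ 0
    c′≡0 = n≤0⇒n≡0 (+-cancelˡ-≤ (2 ^ d) _ 0
             (subst₂ _≤_ (sym e′) (sym (+-identityʳ (2 ^ d))) (toℕ<n c)))

  succ-bottom-top : ∀ c c′ → toℕ (top c′) ≢ suc (toℕ (bottom c))
  succ-bottom-top c c′ = <⇒≢ (s≤s (<⇒≤ (top<bottom c′ c)))

  -- Rotating a glued vector moves the last entry of each block to the front of the other block.
  σ-glue-top-zero : ∀ u v {r L} → toℕ r ≡ 0 → suc (toℕ L) ≡ 2 ^ d → σ (glue u v) (top r) ≡ v L
  σ-glue-top-zero u v {r} {L} r≡0 L-last =
    trans (σ-at-zero (glue u v) (trans (toℕ-top r) r≡0) (last⇒bottom-last L L-last)) (glue-bottom u v L)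

  σ-glue-bottom-zero : ∀ u v {r L} → toℕ r ≡ 0 → suc (toℕ L) ≡ 2 ^ d → σ (glue u v) (bottom r) ≡ u L
  σ-glue-bottom-zero u v {r} {L} r≡0 L-last = trans (σ-at-suc (glue u v) pos) (glue-top u v L)
    where
    pos : toℕ (bottom r) ≡ suc (toℕ (top L))
    pos = trans (toℕ-bottom r) (trans (cong (2 ^ d +_) r≡0)
                (trans (+-identityʳ (2 ^ d)) (trans (sym L-last) (cong suc (sym (toℕ-top L))))))

  σ-glue-top-suc : ∀ u v {r q} → toℕ r ≡ suc (toℕ q) → σ (glue u v) (top r) ≡ u q
  σ-glue-top-suc u v {r} {q} e =
    trans (σ-at-suc (glue u v) (trans (toℕ-top r) (trans e (cong suc (sym (toℕ-top q)))))) (glue-top u v q)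

  σ-glue-bottom-suc : ∀ u v {r q} → toℕ r ≡ suc (toℕ q) → σ (glue u v) (bottom r) ≡ v q
  σ-glue-bottom-suc u v {r} {q} e =
    trans (σ-at-suc (glue u v) (trans (toℕ-bottom r) (trans (cong (2 ^ d +_) e) (sym (suc-toℕ-bottom q)))))
          (glue-bottom u v q)

  σ-glue : ∀ u v → (∀ L → suc (toℕ L) ≡ 2 ^ d → u L ≡ v L) → σ (glue u v) ≗ glue (σ u) (σ v)
  σ-glue u v same-last x with top-or-bottom x
  ... | inj₁ (r , refl) = trans (σ-top r) (sym (glue-top (σ u) (σ v) r))
    where
    σ-top : ∀ r → σ (glue u v) (top r) ≡ σ u r
    σ-top r with zero-or-suc r | ∃-last r
    ... | inj₁ r≡0     | L , L-last = trans (σ-glue-top-zero u v r≡0 L-last)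
                                            (sym (trans (σ-at-zero u r≡0 L-last) (same-last L L-last)))
    ... | inj₂ (q , e) | _          = trans (σ-glue-top-suc u v e) (sym (σ-at-suc u e))
  ... | inj₂ (r , refl) = trans (σ-bottom r) (sym (glue-bottom (σ u) (σ v) r))
    where
    σ-bottom : ∀ r → σ (glue u v) (bottom r) ≡ σ v r
    σ-bottom r with zero-or-suc r | ∃-last r
    ... | inj₁ r≡0     | L , L-last = trans (σ-glue-bottom-zero u v r≡0 L-last)
                                            (trans (same-last L L-last) (sym (σ-at-zero v r≡0 L-last)))
    ... | inj₂ (q , e) | _          = trans (σ-glue-bottom-suc u v e) (sym (σ-at-suc v e))

  Δ-glue : ∀ u v → (∀ L → suc (toℕ L) ≡ 2 ^ d → u L ≡ v L) → Δ (glue u v) ≗ glue (Δ u) (Δ v)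
  Δ-glue u v same-last x =
    trans (cong (_xor glue u v x) (σ-glue u v same-last x)) (glue-⊕ (σ u) (σ v) u v x)

  Δ-glue-ones-zero : ∀ w → (∀ {r} → toℕ r ≡ 0 → w r ≡ true) →
                     (∀ {r q} → toℕ r ≡ suc (toℕ q) → w r ≡ false) →
                     Δ (glue ones zeroV) ≗ glue w w
  Δ-glue-ones-zero w w-first w-rest x with top-or-bottom x
  ... | inj₁ (r , refl) with zero-or-suc r | ∃-last r
  ...   | inj₁ r≡0     | L , L-last =
    trans (cong₂ _xor_ (σ-glue-top-zero ones zeroV r≡0 L-last) (glue-top ones zeroV r))
          (sym (trans (glue-top w w r) (w-first r≡0)))
  ...   | inj₂ (q , e) | _ =
    trans (cong₂ _xor_ (σ-glue-top-suc ones zeroV e) (glue-top ones zeroV r))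
          (sym (trans (glue-top w w r) (w-rest e)))
  Δ-glue-ones-zero w w-first w-rest x | inj₂ (r , refl) with zero-or-suc r | ∃-last r
  ...   | inj₁ r≡0     | L , L-last =
    trans (cong₂ _xor_ (σ-glue-bottom-zero ones zeroV r≡0 L-last) (glue-bottom ones zeroV r))
          (sym (trans (glue-bottom w w r) (w-first r≡0)))
  ...   | inj₂ (q , e) | _ =
    trans (cong₂ _xor_ (σ-glue-bottom-suc ones zeroV e) (glue-bottom ones zeroV r))
          (sym (trans (glue-bottom w w r) (w-rest e)))

  col-top-top : ∀ c r → col (suc d) (top c) (top r) ≡ col d c r
  col-top-top c r = trans (col-top c (top r)) (glue-top (col d c) zeroV r)

  col-top-bottom : ∀ c r → col (suc d) (top c) (bottom r) ≡ false
  col-top-bottom c r = trans (col-top c (bottom r)) (glue-bottom (col d c) zeroV r)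

  col-bottom-top : ∀ c r → col (suc d) (bottom c) (top r) ≡ col d c r
  col-bottom-top c r = trans (col-bottom c (top r)) (glue-top (col d c) (col d c) r)

  col-bottom-bottom : ∀ c r → col (suc d) (bottom c) (bottom r) ≡ col d c r
  col-bottom-bottom c r = trans (col-bottom c (bottom r)) (glue-bottom (col d c) (col d c) r)

M-first-row : ∀ d {c r} → toℕ r ≡ 0 → col d c r ≡ true
M-first-row zero    _ = refl
M-first-row (suc d) {c} {x} x≡0 with top-or-bottom d x
... | inj₂ (r , refl) = contradiction x≡0 (bottom≢0 d r)
... | inj₁ (r , refl) with top-or-bottom d c
...   | inj₁ (c₀ , refl) = trans (col-top-top d c₀ r) (M-first-row d (trans (sym (toℕ-top d r)) x≡0))
...   | inj₂ (c₀ , refl) = trans (col-bottom-top d c₀ r) (M-first-row d (trans (sym (toℕ-top d r)) x≡0))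

M-below-diagonal : ∀ d {c r} → toℕ c < toℕ r → col d c r ≡ false
M-below-diagonal zero {zero} {zero} ()
M-below-diagonal (suc d) {c} {x} c<x with top-or-bottom d c | top-or-bottom d x
... | inj₁ (c₀ , refl) | inj₁ (r , refl) =
  trans (col-top-top d c₀ r) (M-below-diagonal d (subst₂ _<_ (toℕ-top d c₀) (toℕ-top d r) c<x))
... | inj₁ (c₀ , refl) | inj₂ (r , refl) = col-top-bottom d c₀ r
... | inj₂ (c₀ , refl) | inj₁ (r , refl) = contradiction c<x (<-asym (top<bottom d r c₀))
... | inj₂ (c₀ , refl) | inj₂ (r , refl) =
  trans (col-bottom-bottom d c₀ r)
        (M-below-diagonal d (+-cancelˡ-< (2 ^ d) _ _ (subst₂ _<_ (toℕ-bottom d c₀) (toℕ-bottom d r) c<x)))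

M-last-column : ∀ d {c r} → suc (toℕ c) ≡ 2 ^ d → col d c r ≡ true
M-last-column zero    _ = refl
M-last-column (suc d) {c} {x} c-last with top-or-bottom d c
... | inj₁ (c₀ , refl) = contradiction c-last (top-not-last d c₀)
... | inj₂ (c₀ , refl) with top-or-bottom d x
...   | inj₁ (r , refl) = trans (col-bottom-top d c₀ r) (M-last-column d (bottom-last⇒last d c₀ c-last))
...   | inj₂ (r , refl) = trans (col-bottom-bottom d c₀ r) (M-last-column d (bottom-last⇒last d c₀ c-last))

Δ-col-succ : ∀ d {c c′} → toℕ c′ ≡ suc (toℕ c) → Δ (col d c) ≗ col d c′
Δ-col-succ zero {zero} {zero} ()
Δ-col-succ (suc d) {c} {c′} e x with top-or-bottom d c | top-or-bottom d c′
... | inj₂ (c₀ , refl) | inj₁ (c₁ , refl) = contradiction e (succ-bottom-top d c₀ c₁)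
... | inj₂ (c₀ , refl) | inj₂ (c₁ , refl) = begin
  Δ (col (suc d) (bottom d c₀)) x       ≡⟨ Δ-cong (col-bottom d c₀) x ⟩
  Δ (glue d C₀ C₀) x                    ≡⟨ Δ-glue d C₀ C₀ (λ _ _ → refl) x ⟩
  glue d (Δ C₀) (Δ C₀) x                ≡⟨ glue-cong d IH IH x ⟩
  glue d C₁ C₁ x                        ≡⟨ sym (col-bottom d c₁ x) ⟩
  col (suc d) (bottom d c₁) x           ∎
  where
  open ≡-Reasoning
  C₀ C₁ : Vec₂ (2 ^ d)
  C₀ = col d c₀
  C₁ = col d c₁
  IH : Δ C₀ ≗ C₁
  IH = Δ-col-succ d (succ-bottom-bottom d e)
... | inj₁ (c₀ , refl) | inj₁ (c₁ , refl) = begin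
  Δ (col (suc d) (top d c₀)) x          ≡⟨ Δ-cong (col-top d c₀) x ⟩
  Δ (glue d C₀ zeroV) x                 ≡⟨ Δ-glue d C₀ zeroV last-zero x ⟩
  glue d (Δ C₀) (Δ zeroV) x             ≡⟨ glue-cong d (Δ-col-succ d c₁≡1+c₀) (Δ-const false) x ⟩
  glue d C₁ zeroV x                     ≡⟨ sym (col-top d c₁ x) ⟩
  col (suc d) (top d c₁) x              ∎
  where
  open ≡-Reasoning
  C₀ C₁ : Vec₂ (2 ^ d)
  C₀ = col d c₀
  C₁ = col d c₁
  c₁≡1+c₀ : toℕ c₁ ≡ suc (toℕ c₀)
  c₁≡1+c₀ = succ-top-top d e
  last-zero : ∀ L → suc (toℕ L) ≡ 2 ^ d → C₀ L ≡ false
  last-zero L L-last = M-below-diagonal d (s≤s⁻¹ (subst₂ _≤_ (cong suc c₁≡1+c₀) (sym L-last) (toℕ<n c₁)))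
... | inj₁ (c₀ , refl) | inj₂ (c₁ , refl) = begin
  Δ (col (suc d) (top d c₀)) x          ≡⟨ Δ-cong col≗glue-ones x ⟩
  Δ (glue d ones zeroV) x               ≡⟨ Δ-glue-ones-zero d C₁ (M-first-row d) C₁-rest x ⟩
  glue d C₁ C₁ x                        ≡⟨ sym (col-bottom d c₁ x) ⟩
  col (suc d) (bottom d c₁) x           ∎
  where
  open ≡-Reasoning
  C₁ : Vec₂ (2 ^ d)
  C₁ = col d c₁
  c₁≡0 : toℕ c₁ ≡ 0
  c₁≡0 = proj₁ (succ-top-bottom d e)
  c₀-last : suc (toℕ c₀) ≡ 2 ^ d
  c₀-last = proj₂ (succ-top-bottom d e)
  col≗glue-ones : col (suc d) (top d c₀) ≗ glue d ones zeroV
  col≗glue-ones y = trans (col-top d c₀ y) (glue-cong d (λ _ → M-last-column d c₀-last) (λ _ → refl) y)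
  C₁-rest : ∀ {r q} → toℕ r ≡ suc (toℕ q) → C₁ r ≡ false
  C₁-rest r≡1+q = M-below-diagonal d (subst₂ _<_ (sym c₁≡0) (sym r≡1+q) z<s)

Δ-col-last : ∀ d {c} → suc (toℕ c) ≡ 2 ^ d → Δ (col d c) ≗ zeroV
Δ-col-last d c-last x = trans (Δ-cong (λ _ → M-last-column d c-last) x) (Δ-const true x)

-- laterComb d i b unfolds to Span.comb (later i) (col d) b, so lemma10 asserts membership in this span.
later : ∀ {m} → Fin m → Fin m → Bool
later i j = ⌊ toℕ i <? toℕ j ⌋

<⇒later : ∀ {m} {i j : Fin m} → toℕ i < toℕ j → later i j ≡ true
<⇒later {i = i} {j} i<j with toℕ i <? toℕ j
... | yes _     = refl
... | no i≮j = contradiction i<j i≮j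

later⇒< : ∀ {m} {i j : Fin m} → later i j ≡ true → toℕ i < toℕ j
later⇒< {i = i} {j} with toℕ i <? toℕ j
... | yes i<j = λ _ → i<j
... | no _    = λ ()

module _ (d : ℕ) {i : Fin (2 ^ d)} where
  open Span (later i) (col d)

  Δ-col-inSpan : ∀ {j} → toℕ i ≤ toℕ j → InSpan (Δ (col d j))
  Δ-col-inSpan {j} i≤j with m≤n⇒m<n∨m≡n (toℕ<n j)
  ... | inj₂ j-last   = inSpan-resp (Δ-col-last d j-last) zero-inSpan
  ... | inj₁ j+1<2^d = inSpan-resp (Δ-col-succ d (toℕ-fromℕ< j+1<2^d))
                          (generator-inSpan (fromℕ< j+1<2^d) (<⇒later i<j+1))
    where
    i<j+1 : toℕ i < toℕ (fromℕ< j+1<2^d)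
    i<j+1 = subst (toℕ i <_) (sym (toℕ-fromℕ< j+1<2^d)) (s≤s i≤j)

  σ-col-inSpan : ∀ {j} → toℕ i < toℕ j → InSpan (σ (col d j))
  σ-col-inSpan {j} i<j = inSpan-resp (σ-via-Δ (col d j))
    (⊕-inSpan (Δ-col-inSpan (<⇒≤ i<j)) (generator-inSpan j (<⇒later i<j)))

lemma10 : (d : ℕ) (i : Fin (2 ^ d)) (k : ℕ) →
    ∃ λ (b : Fin (2 ^ d) → Bool) →
    (r : Fin (2 ^ d)) → (σ^ k (col d i) ⊕ col d i) r ≡ laterComb d i b r
lemma10 d i zero    = inSpan-resp (λ r → xor-same (col d i r)) zero-inSpan
  where open Span (later i) (col d)
lemma10 d i (suc k) = inSpan-resp (σ-⊕-telescope (σ^ k (col d i)) (col d i))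
  (⊕-inSpan (σ-inSpan (λ j → σ-col-inSpan d ∘ later⇒<) (lemma10 d i k)) (Δ-col-inSpan d ≤-refl))
  where open Span (later i) (col d)
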